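{- For integers $r$, $n\ge0$ and $i$, let $v_r(n)$ be the number of permutations of $[n]$ with exactly $r$ occurrences of the pattern $23\text{ - }1$, and $v_r(n;i)$ the number of such permutations $a_1\cdots a_n$ with $a_1=i$; set $v_r(n)=v_r(n;i)=0$ when $r<0$. Let $n\ge1$. Then $v_r(n;1)=v_r(n;n)=v_r(n-1)$, and for every $2\le i\le n-1$, $$v_r(n;i)=\sum_{j=1}^{i-1}v_r(n-1;j)+\sum_{j=i}^{n-1}v_{r-i+1}(n-1;j).$$
   Context: An occurrence of the pattern $23\text{ - }1$ in a permutation $a_1a_2\cdots a_n$ is a pair of indices $(i,j)$ with $i+1<j\le n$ such that $a_j<a_i<a_{i+1}$. The empty permutation has no occurrences. -}

module Defs where

open import Data.Nat using (ℕ; zero; suc; _+_; _∸_; _<_; _<?_; _≟_)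
open import Data.Integer as ℤ using (ℤ; +_; -[1+_])
open import Data.List using (List; []; _∷_; map; concatMap; filter; length; head)
open import Data.List.Relation.Unary.Unique.Propositional using (Unique)
open import Data.List.Relation.Unary.Unique.Propositional.Properties using ()
open import Data.List.Relation.Unary.AllPairs using (allPairs?)
open import Data.Maybe using (Maybe; just; nothing)
open import Relation.Nullary using (Dec; yes; no; ¬?; does)
open import Data.Bool using (if_then_else_)
open import Data.Nat.ListAction using (sum)
open import Relation.Binary.PropositionalEquality using (_≡_)
import Data.Maybe.Properties as MP

range1 : ℕ → List ℕ
range1 zero = []
range1 (suc n) = range1 n Data.List.++ (suc n ∷ [])

words : List ℕ → ℕ → List (List ℕ)
words xs zero = [] ∷ []
words xs (suc k) = concatMap (λ x → map (x ∷_) (words xs k)) xs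

-- permutations of [n] in one-line notation a₁ a₂ ⋯ aₙ :
-- words of length n over {1,…,n} with pairwise distinct letters
perms : ℕ → List (List ℕ)
perms n = filter (λ w → allPairs? (λ x y → ¬? (x ≟ y)) w) (words (range1 n) n)

countBelow : ℕ → List ℕ → ℕ
countBelow m [] = 0
countBelow m (x ∷ xs) with x <? m
... | yes _ = suc (countBelow m xs)
... | no _ = countBelow m xs

-- number of occurrences of 23-1: pairs (i,j), i+1<j, a_j < a_i < a_{i+1}
occ231 : List ℕ → ℕ
occFrom : ℕ → List ℕ → ℕ

occ231 [] = 0
occ231 (x ∷ xs) = occFrom x xs

occFrom x [] = 0
occFrom x (y ∷ rest) = (if does (x <? y) then countBelow x rest else 0) + occFrom y rest

countExact : ℕ → List (List ℕ) → ℕ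
countExact r ps = length (filter (λ w → occ231 w ≟ r) ps)

startsWith : ℕ → List ℕ → Set
startsWith i w = head w ≡ just i

startsWith? : (i : ℕ) (w : List ℕ) → Dec (startsWith i w)
startsWith? i w = MP.≡-dec _≟_ (head w) (just i)

v : ℤ → ℕ → ℕ
v (+ r) n = countExact r (perms n)
v -[1+ _ ] n = 0

vi : ℤ → ℕ → ℕ → ℕ
vi (+ r) n i = countExact r (filter (startsWith? i) (perms n))
vi -[1+ _ ] n i = 0

sumFromTo : ℕ → ℕ → (ℕ → ℕ) → ℕ
sumFromTo a b f = sum (map f (filter (λ j → a Data.Nat.≤? j) (range1 b)))

module Submission where

-- A permutation of [m + 1] starting with i is  extend i w = i ∷ map (punchIn i) w  for a unique
-- permutation w of [m], punchIn i raising the letters ≥ i by one. As punchIn i is order preserving, the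
-- occurrences of 23-1 avoiding position 1 are exactly those of w. The occurrences (1, j) need a₂ > i,
-- and then they are the positions of the i - 1 letters below i, all of which lie after position 2.
-- So w contributes to v_r(m + 1; i) through v_r(m; j) if its first letter j is below i and through
-- v_{r-i+1}(m; j) otherwise; for i = 1 and i = m + 1 nothing is ever added.

open import Defs
open import Algebra.Properties.CommutativeSemigroup using (interchange)
open import Data.Bool using (if_then_else_)
open import Data.Integer as ℤ using (ℤ)
import Data.Integer.Properties as ℤ
open import Data.Integer.Solver using (module +-*-Solver)
open import Data.List using (List; []; _∷_; _++_; [_]; map; concatMap; filter; length)
import Data.List.Properties as List
open import Data.List.Relation.Unary.All as All using (All; []; _∷_)
import Data.List.Relation.Unary.All.Properties as All
open import Data.List.Relation.Unary.AllPairs as AllPairs using (AllPairs; []; _∷_; allPairs?)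
import Data.List.Relation.Unary.AllPairs.Properties as AllPairs
import Data.Maybe.Properties as Maybe
open import Data.Nat using (ℕ; zero; suc; _+_; _∸_; _≤_; _<_; _≤?_; _<?_; _≟_; z≤n; s≤s)
open import Data.Nat.ListAction using (sum)
open import Data.Nat.ListAction.Properties using (sum-++)
open import Data.Nat.Properties
open import Data.Product using (_×_; ∃-syntax; _,_; proj₁; proj₂)
open import Data.Sum using (inj₁; inj₂)
open import Function using (_∘_; _⇔_; mk⇔; Equivalence)
open import Relation.Binary.Definitions using (tri<; tri≈; tri>)
open import Relation.Binary.PropositionalEquality
  using (_≡_; _≢_; ≢-sym; refl; sym; trans; cong; cong₂; subst; module ≡-Reasoning)
open import Relation.Nullary using (Dec; yes; no; does; ¬?; _×-dec_; contradiction)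
open import Relation.Nullary.Decidable using (dec-true; dec-false)
open import Relation.Unary using (Decidable)

open Equivalence using (to; from)

filter-map : ∀ {a b p} {A : Set a} {B : Set b} {P : B → Set p} (P? : Decidable P) (f : A → B) xs →
             filter P? (map f xs) ≡ map f (filter (P? ∘ f) xs)
filter-map P? f [] = refl
filter-map P? f (x ∷ xs) with P? (f x)
... | yes _ = cong (f x ∷_) (filter-map P? f xs)
... | no _ = filter-map P? f xs

module _ {a} {A : Set a} where

  filter-≐-local : ∀ {p q} {P : A → Set p} {Q : A → Set q} (P? : Decidable P) (Q? : Decidable Q) {xs} →
                   All (λ x → P x ⇔ Q x) xs → filter P? xs ≡ filter Q? xs
  filter-≐-local P? Q? [] = refl
  filter-≐-local P? Q? {x ∷ xs} (P⇔Q ∷ rest) with P? x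
  ... | yes px = trans (cong (x ∷_) (filter-≐-local P? Q? rest)) (sym (List.filter-accept Q? (to P⇔Q px)))
  ... | no ¬px = trans (filter-≐-local P? Q? rest) (sym (List.filter-reject Q? (¬px ∘ from P⇔Q)))

  filter-filter : ∀ {p q} {P : A → Set p} {Q : A → Set q} (P? : Decidable P) (Q? : Decidable Q) xs →
                  filter P? (filter Q? xs) ≡ filter (λ x → P? x ×-dec Q? x) xs
  filter-filter P? Q? [] = refl
  filter-filter P? Q? (x ∷ xs) with Q? x
  ... | no _ with P? x
  ...   | yes _ = filter-filter P? Q? xs
  ...   | no _ = filter-filter P? Q? xs
  filter-filter P? Q? (x ∷ xs) | yes _ with P? x
  ...   | yes _ = cong (x ∷_) (filter-filter P? Q? xs)
  ...   | no _ = filter-filter P? Q? xs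

  consAll : List A → List (List A) → List (List A)
  consAll xs W = concatMap (λ x → map (x ∷_) W) xs

  consAll-map : ∀ (h : A → A) xs W → consAll (map h xs) (map (map h) W) ≡ map (map h) (consAll xs W)
  consAll-map h [] W = refl
  consAll-map h (x ∷ xs) W = begin
    map (h x ∷_) (map (map h) W) ++ consAll (map h xs) (map (map h) W)
      ≡⟨ cong₂ _++_ (trans (sym (List.map-∘ W)) (List.map-∘ W)) (consAll-map h xs W) ⟩
    map (map h) (map (x ∷_) W) ++ map (map h) (consAll xs W)
      ≡⟨ List.map-++ (map h) (map (x ∷_) W) _ ⟨
    map (map h) (consAll (x ∷ xs) W) ∎
    where open ≡-Reasoning

  filter-consAll : ∀ {p q r} {P : List A → Set p} {Q : A → Set q} {R : List A → Set r}
                   (P? : Decidable P) (Q? : Decidable Q) (R? : Decidable R) →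
                   (∀ x w → P (x ∷ w) ⇔ (Q x × R w)) →
                   ∀ xs W → filter P? (consAll xs W) ≡ consAll (filter Q? xs) (filter R? W)
  filter-consAll P? Q? R? P⇔ [] W = refl
  filter-consAll P? Q? R? P⇔ (x ∷ xs) W = begin
    filter P? (map (x ∷_) W ++ consAll xs W)
      ≡⟨ List.filter-++ P? (map (x ∷_) W) _ ⟩
    filter P? (map (x ∷_) W) ++ filter P? (consAll xs W)
      ≡⟨ cong₂ _++_ (filter-map P? (x ∷_) W) (filter-consAll P? Q? R? P⇔ xs W) ⟩
    map (x ∷_) (filter (P? ∘ (x ∷_)) W) ++ consAll (filter Q? xs) (filter R? W)
      ≡⟨ head-step ⟩
    consAll (filter Q? (x ∷ xs)) (filter R? W) ∎
    where
    open ≡-Reasoning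
    head-step : map (x ∷_) (filter (P? ∘ (x ∷_)) W) ++ consAll (filter Q? xs) (filter R? W)
              ≡ consAll (filter Q? (x ∷ xs)) (filter R? W)
    head-step with Q? x
    ... | yes qx = cong (λ V → map (x ∷_) V ++ _)
                     (List.filter-≐ _ R? (proj₂ ∘ to (P⇔ x _) , λ r → from (P⇔ x _) (qx , r)) W)
    ... | no ¬qx = cong (λ V → map (x ∷_) V ++ _)
                     (List.filter-none _ (All.universal (λ w → ¬qx ∘ proj₁ ∘ to (P⇔ x w)) W))

sum-map-snoc : ∀ (F : ℕ → ℕ) xs x → sum (map F (xs ++ [ x ])) ≡ sum (map F xs) + F x
sum-map-snoc F xs x = begin
  sum (map F (xs ++ [ x ]))       ≡⟨ cong sum (List.map-++ F xs [ x ]) ⟩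
  sum (map F xs ++ [ F x ])       ≡⟨ sum-++ (map F xs) [ F x ] ⟩
  sum (map F xs) + (F x + 0)      ≡⟨ cong (sum (map F xs) +_) (+-identityʳ (F x)) ⟩
  sum (map F xs) + F x            ∎
  where open ≡-Reasoning

sum-map-+ : ∀ (F G : ℕ → ℕ) xs → sum (map (λ j → F j + G j) xs) ≡ sum (map F xs) + sum (map G xs)
sum-map-+ F G [] = refl
sum-map-+ F G (x ∷ xs) = trans (cong (F x + G x +_) (sum-map-+ F G xs))
                              (interchange +-commutativeSemigroup (F x) (G x) _ _)

sum-map-0 : ∀ {F : ℕ → ℕ} {xs} → All (λ j → F j ≡ 0) xs → sum (map F xs) ≡ 0
sum-map-0 [] = refl
sum-map-0 (Fx≡0 ∷ rest) = cong₂ _+_ Fx≡0 (sum-map-0 rest)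

InRange : ℕ → ℕ → Set
InRange m x = 1 ≤ x × x ≤ m

range1-inRange : ∀ m → All (InRange m) (range1 m)
range1-inRange zero = []
range1-inRange (suc m) =
  All.++⁺ (All.map (λ (1≤x , x≤m) → 1≤x , m≤n⇒m≤1+n x≤m) (range1-inRange m)) ((s≤s z≤n , ≤-refl) ∷ [])

sum-range1-suc : ∀ (F : ℕ → ℕ) k → sum (map F (range1 (suc k))) ≡ sum (map F (range1 k)) + F (suc k)
sum-range1-suc F k = sum-map-snoc F (range1 k) (suc k)

sum-range1-single : ∀ {F : ℕ → ℕ} {y k} → InRange k y → (∀ j → j ≢ y → F j ≡ 0) → sum (map F (range1 k)) ≡ F y
sum-range1-single {k = zero} (s≤s _ , ()) _
sum-range1-single {F} {y} {suc k} (1≤y , y≤1+k) F≡0 with m≤n⇒m<n∨m≡n y≤1+k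
... | inj₁ (s≤s y≤k) = begin
  sum (map F (range1 (suc k)))         ≡⟨ sum-range1-suc F k ⟩
  sum (map F (range1 k)) + F (suc k)   ≡⟨ cong₂ _+_ (sum-range1-single (1≤y , y≤k) F≡0)
                                                   (F≡0 (suc k) (λ eq → <-irrefl (sym eq) (s≤s y≤k))) ⟩
  F y + 0                              ≡⟨ +-identityʳ (F y) ⟩
  F y                                  ∎
  where open ≡-Reasoning
... | inj₂ refl = trans (sum-range1-suc F k) (cong (_+ F y)
  (sum-map-0 (All.map (λ (_ , j≤k) → F≡0 _ (λ eq → <-irrefl eq (s≤s j≤k))) (range1-inRange k))))

sumFromTo-suc : ∀ {a b} (F : ℕ → ℕ) → a ≤ suc b → sumFromTo a (suc b) F ≡ sumFromTo a b F + F (suc b)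
sumFromTo-suc {a} {b} F a≤1+b = begin
  sum (map F (filter (a ≤?_) (range1 b ++ [ suc b ])))
    ≡⟨ cong (sum ∘ map F) (List.filter-++ (a ≤?_) (range1 b) [ suc b ]) ⟩
  sum (map F (filter (a ≤?_) (range1 b) ++ filter (a ≤?_) [ suc b ]))
    ≡⟨ cong (λ xs → sum (map F (filter (a ≤?_) (range1 b) ++ xs))) (List.filter-accept (a ≤?_) a≤1+b) ⟩
  sum (map F (filter (a ≤?_) (range1 b) ++ [ suc b ]))
    ≡⟨ sum-map-snoc F (filter (a ≤?_) (range1 b)) (suc b) ⟩
  sumFromTo a b F + F (suc b) ∎
  where open ≡-Reasoning

sumFromTo-empty : ∀ {a b} (F : ℕ → ℕ) → b < a → sumFromTo a b F ≡ 0
sumFromTo-empty {a} {b} F b<a = cong (sum ∘ map F)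
  (List.filter-none (a ≤?_) (All.map (λ (_ , j≤b) → <⇒≱ (≤-<-trans j≤b b<a)) (range1-inRange b)))

sumFromTo-1 : ∀ b (F : ℕ → ℕ) → sumFromTo 1 b F ≡ sum (map F (range1 b))
sumFromTo-1 b F = cong (sum ∘ map F) (List.filter-all (1 ≤?_) (All.map proj₁ (range1-inRange b)))

sumFromTo-cong : ∀ {a b} {F G : ℕ → ℕ} → (∀ {j} → a ≤ j → j ≤ b → F j ≡ G j) → sumFromTo a b F ≡ sumFromTo a b G
sumFromTo-cong {a} {b} F≡G = cong sum (List.map-cong-local
  (All.zipWith (λ (a≤j , (_ , j≤b)) → F≡G a≤j j≤b)
    (All.all-filter (a ≤?_) (range1 b) , All.filter⁺ (a ≤?_) (range1-inRange b))))

sum-range1-split : ∀ (F : ℕ → ℕ) {i} m → i ≤ suc m → sum (map F (range1 m)) ≡ sumFromTo 1 (i ∸ 1) F + sumFromTo i m F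
sum-range1-split F {zero} zero _ = refl
sum-range1-split F {suc zero} zero _ = refl
sum-range1-split F {suc (suc _)} zero (s≤s ())
sum-range1-split F {i} (suc m) i≤2+m with m≤n⇒m<n∨m≡n i≤2+m
... | inj₁ (s≤s i≤1+m) = begin
  sum (map F (range1 (suc m)))                                ≡⟨ sum-range1-suc F m ⟩
  sum (map F (range1 m)) + F (suc m)                          ≡⟨ cong (_+ F (suc m)) (sum-range1-split F m i≤1+m) ⟩
  sumFromTo 1 (i ∸ 1) F + sumFromTo i m F + F (suc m)         ≡⟨ +-assoc (sumFromTo 1 (i ∸ 1) F) _ _ ⟩
  sumFromTo 1 (i ∸ 1) F + (sumFromTo i m F + F (suc m))       ≡⟨ cong (sumFromTo 1 (i ∸ 1) F +_) (sumFromTo-suc F i≤1+m) ⟨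
  sumFromTo 1 (i ∸ 1) F + sumFromTo i (suc m) F               ∎
  where open ≡-Reasoning
... | inj₂ refl = begin
  sum (map F (range1 (suc m)))                                ≡⟨ sumFromTo-1 (suc m) F ⟨
  sumFromTo 1 (suc m) F                                       ≡⟨ +-identityʳ _ ⟨
  sumFromTo 1 (suc m) F + 0                                   ≡⟨ cong (sumFromTo 1 (suc m) F +_) (sumFromTo-empty {b = suc m} F ≤-refl) ⟨
  sumFromTo 1 (suc m) F + sumFromTo (suc (suc m)) (suc m) F   ∎
  where open ≡-Reasoning

punchIn : ℕ → ℕ → ℕ
punchIn i x = if does (i ≤? x) then suc x else x

punchIn-< : ∀ {i x} → x < i → punchIn i x ≡ x
punchIn-< {i} {x} x<i rewrite dec-false (i ≤? x) (<⇒≱ x<i) = refl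

punchIn-≥ : ∀ {i x} → i ≤ x → punchIn i x ≡ suc x
punchIn-≥ {i} {x} i≤x rewrite dec-true (i ≤? x) i≤x = refl

punchIn-mono-< : ∀ i {x y} → x < y → punchIn i x < punchIn i y
punchIn-mono-< i {x} {y} x<y with i ≤? x | i ≤? y
... | yes i≤x | yes i≤y rewrite punchIn-≥ i≤x | punchIn-≥ i≤y = s≤s x<y
... | yes i≤x | no i≰y = contradiction (≤-trans i≤x (<⇒≤ x<y)) i≰y
... | no i≰x | yes i≤y rewrite punchIn-< (≰⇒> i≰x) | punchIn-≥ i≤y = m≤n⇒m≤1+n x<y
... | no i≰x | no i≰y rewrite punchIn-< (≰⇒> i≰x) | punchIn-< (≰⇒> i≰y) = x<y

punchIn-<⇔ : ∀ i {x y} → punchIn i x < punchIn i y ⇔ x < y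
punchIn-<⇔ i {x} {y} = mk⇔ reflect (punchIn-mono-< i)
  where
  reflect : punchIn i x < punchIn i y → x < y
  reflect pix<piy with <-cmp x y
  ... | tri< x<y _ _ = x<y
  ... | tri≈ _ refl _ = contradiction pix<piy (<-irrefl refl)
  ... | tri> _ _ y<x = contradiction (punchIn-mono-< i y<x) (<⇒≯ pix<piy)

punchIn-injective : ∀ i {x y} → punchIn i x ≡ punchIn i y → x ≡ y
punchIn-injective i {x} {y} eq with <-cmp x y
... | tri< x<y _ _ = contradiction eq (<⇒≢ (punchIn-mono-< i x<y))
... | tri≈ _ x≡y _ = x≡y
... | tri> _ _ y<x = contradiction (sym eq) (<⇒≢ (punchIn-mono-< i y<x))

punchIn-<-self⇔ : ∀ i {y} → punchIn i y < i ⇔ y < i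
punchIn-<-self⇔ i {y} = mk⇔ reflect (λ y<i → subst (_< i) (sym (punchIn-< y<i)) y<i)
  where
  reflect : punchIn i y < i → y < i
  reflect piy<i with y <? i
  ... | yes y<i = y<i
  ... | no y≮i = contradiction (m≤n⇒m≤1+n (≮⇒≥ y≮i)) (<⇒≱ (subst (_< i) (punchIn-≥ (≮⇒≥ y≮i)) piy<i))

_≢?_ : (x y : ℕ) → Dec (x ≢ y)
x ≢? y = ¬? (x ≟ y)

distinct? : Decidable (AllPairs _≢_)
distinct? = allPairs? _≢?_

words-inRange : ∀ {m} xs → All (InRange m) xs → ∀ k → All (λ w → All (InRange m) w × length w ≡ k) (words xs k)
words-inRange xs xs-in zero = ([] , refl) ∷ []
words-inRange {m} xs xs-in (suc k) = consAll-inRange xs xs-in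
  where
  consAll-inRange : ∀ ys → All (InRange m) ys → All (λ w → All (InRange m) w × length w ≡ suc k) (consAll ys (words xs k))
  consAll-inRange [] [] = []
  consAll-inRange (y ∷ ys) (y-in ∷ ys-in) =
    All.++⁺ (All.map⁺ (All.map (λ (w-in , len) → (y-in ∷ w-in) , cong suc len) (words-inRange xs xs-in k)))
            (consAll-inRange ys ys-in)

words-map : ∀ (h : ℕ → ℕ) xs k → words (map h xs) k ≡ map (map h) (words xs k)
words-map h xs zero = refl
words-map h xs (suc k) rewrite words-map h xs k = consAll-map h xs (words xs k)

filter-words-avoiding : ∀ i xs k → filter (All.all? (i ≢?_)) (words xs k) ≡ words (filter (i ≢?_) xs) k
filter-words-avoiding i xs zero = refl
filter-words-avoiding i xs (suc k) = begin
  filter (All.all? (i ≢?_)) (consAll xs (words xs k))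
    ≡⟨ filter-consAll _ (i ≢?_) (All.all? (i ≢?_))
         (λ x w → mk⇔ (λ { (i≢x ∷ i∉w) → i≢x , i∉w }) (λ (i≢x , i∉w) → i≢x ∷ i∉w)) xs _ ⟩
  consAll (filter (i ≢?_) xs) (filter (All.all? (i ≢?_)) (words xs k))
    ≡⟨ cong (consAll (filter (i ≢?_) xs)) (filter-words-avoiding i xs k) ⟩
  words (filter (i ≢?_) xs) (suc k) ∎
  where open ≡-Reasoning

range1-filter-≡ : ∀ {i k} → InRange k i → filter (_≟ i) (range1 k) ≡ [ i ]
range1-filter-≡ {k = zero} (s≤s _ , ())
range1-filter-≡ {i} {suc k} (1≤i , i≤1+k)
  rewrite List.filter-++ (_≟ i) (range1 k) [ suc k ] with m≤n⇒m<n∨m≡n i≤1+k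
... | inj₁ (s≤s i≤k) = cong₂ _++_ (range1-filter-≡ (1≤i , i≤k))
                                  (List.filter-reject (_≟ i) (λ eq → <-irrefl (sym eq) (s≤s i≤k)))
... | inj₂ refl = cong₂ _++_
  (List.filter-none (_≟ i) (All.map (λ (_ , j≤k) eq → <-irrefl eq (s≤s j≤k)) (range1-inRange k)))
  (List.filter-accept (_≟ i) refl)

range1-filter-≢ : ∀ {i m} → InRange (suc m) i → filter (i ≢?_) (range1 (suc m)) ≡ map (punchIn i) (range1 m)
range1-filter-≢ {suc zero} {zero} _ = refl
range1-filter-≢ {suc (suc _)} {zero} (_ , s≤s ())
range1-filter-≢ {i} {suc m} (1≤i , i≤2+m) with m≤n⇒m<n∨m≡n i≤2+m
... | inj₁ (s≤s i≤1+m) = begin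
  filter (i ≢?_) (range1 (suc m) ++ [ suc (suc m) ])
    ≡⟨ List.filter-++ (i ≢?_) (range1 (suc m)) _ ⟩
  filter (i ≢?_) (range1 (suc m)) ++ filter (i ≢?_) [ suc (suc m) ]
    ≡⟨ cong₂ _++_ (range1-filter-≢ (1≤i , i≤1+m)) (List.filter-accept (i ≢?_) (<⇒≢ (s≤s i≤1+m))) ⟩
  map (punchIn i) (range1 m) ++ [ suc (suc m) ]
    ≡⟨ cong (λ x → map (punchIn i) (range1 m) ++ [ x ]) (punchIn-≥ i≤1+m) ⟨
  map (punchIn i) (range1 m) ++ [ punchIn i (suc m) ]
    ≡⟨ List.map-++ (punchIn i) (range1 m) _ ⟨
  map (punchIn i) (range1 (suc m)) ∎
  where open ≡-Reasoning
... | inj₂ refl = begin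
  filter (i ≢?_) (range1 (suc m) ++ [ i ])
    ≡⟨ List.filter-++ (i ≢?_) (range1 (suc m)) _ ⟩
  filter (i ≢?_) (range1 (suc m)) ++ filter (i ≢?_) [ i ]
    ≡⟨ cong₂ _++_
         (List.filter-all (i ≢?_) (All.map (λ (_ , j≤1+m) → ≢-sym (<⇒≢ (s≤s j≤1+m))) (range1-inRange (suc m))))
                  (List.filter-reject (i ≢?_) (λ i≢i → i≢i refl)) ⟩
  range1 (suc m) ++ []
    ≡⟨ List.++-identityʳ _ ⟩
  range1 (suc m)
    ≡⟨ List.map-id-local (All.map (λ (_ , j≤1+m) → punchIn-< (s≤s j≤1+m)) (range1-inRange (suc m))) ⟨
  map (punchIn i) (range1 (suc m)) ∎
  where open ≡-Reasoning

filter-distinct-map : ∀ {f : ℕ → ℕ} → (∀ {x y} → f x ≡ f y → x ≡ y) → ∀ W →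
                      filter distinct? (map (map f) W) ≡ map (map f) (filter distinct? W)
filter-distinct-map {f} f-inj W = trans (filter-map distinct? (map f) W) (cong (map (map f)) (List.filter-≐ _ distinct?
  ( (λ d → AllPairs.map (λ fx≢fy → fx≢fy ∘ cong f) (AllPairs.map⁻ d))
  , (λ d → AllPairs.map⁺ (AllPairs.map (λ x≢y → x≢y ∘ f-inj) d)) ) W))

extend : ℕ → List ℕ → List ℕ
extend i w = i ∷ map (punchIn i) w

perms-startsWith : ∀ {i m} → InRange (suc m) i → filter (startsWith? i) (perms (suc m)) ≡ map (extend i) (perms m)
perms-startsWith {i} {m} i-in = begin
  filter (startsWith? i) (filter distinct? (consAll R W))
    ≡⟨ filter-filter (startsWith? i) distinct? (consAll R W) ⟩
  filter (λ w → startsWith? i w ×-dec distinct? w) (consAll R W)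
    ≡⟨ filter-consAll _ (_≟ i) (λ w → distinct? w ×-dec avoids? w) cons⇔ R W ⟩
  consAll (filter (_≟ i) R) (filter (λ w → distinct? w ×-dec avoids? w) W)
    ≡⟨ cong (λ xs → consAll xs (filter (λ w → distinct? w ×-dec avoids? w) W)) (range1-filter-≡ i-in) ⟩
  map (i ∷_) (filter (λ w → distinct? w ×-dec avoids? w) W) ++ []
    ≡⟨ List.++-identityʳ _ ⟩
  map (i ∷_) (filter (λ w → distinct? w ×-dec avoids? w) W)
    ≡⟨ cong (map (i ∷_)) (filter-filter distinct? avoids? W) ⟨
  map (i ∷_) (filter distinct? (filter avoids? W))
    ≡⟨ cong (map (i ∷_) ∘ filter distinct?) (filter-words-avoiding i R m) ⟩
  map (i ∷_) (filter distinct? (words (filter (i ≢?_) R) m))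
    ≡⟨ cong (λ xs → map (i ∷_) (filter distinct? (words xs m))) (range1-filter-≢ i-in) ⟩
  map (i ∷_) (filter distinct? (words (map (punchIn i) (range1 m)) m))
    ≡⟨ cong (map (i ∷_) ∘ filter distinct?) (words-map (punchIn i) (range1 m) m) ⟩
  map (i ∷_) (filter distinct? (map (map (punchIn i)) (words (range1 m) m)))
    ≡⟨ cong (map (i ∷_)) (filter-distinct-map (punchIn-injective i) (words (range1 m) m)) ⟩
  map (i ∷_) (map (map (punchIn i)) (perms m))
    ≡⟨ List.map-∘ (perms m) ⟨
  map (extend i) (perms m) ∎
  where
  open ≡-Reasoning
  R : List ℕ
  R = range1 (suc m)
  W : List (List ℕ)
  W = words R m
  avoids? : Decidable (All (i ≢_))
  avoids? = All.all? (i ≢?_)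
  cons⇔ : ∀ x w → (startsWith i (x ∷ w) × AllPairs _≢_ (x ∷ w)) ⇔ (x ≡ i × (AllPairs _≢_ w × All (i ≢_) w))
  cons⇔ x w = mk⇔ (λ { (refl , i∉w ∷ d) → refl , d , i∉w }) (λ { (refl , d , i∉w) → refl , i∉w ∷ d })

record IsPerm (m : ℕ) (w : List ℕ) : Set where
  field
    distinct : AllPairs _≢_ w
    inRange  : All (InRange m) w
    length≡  : length w ≡ m

perms-isPerm : ∀ m → All (IsPerm m) (perms m)
perms-isPerm m = All.zipWith (λ (d , (r , l)) → record { distinct = d ; inRange = r ; length≡ = l })
  ( All.all-filter distinct? (words (range1 m) m)
  , All.filter⁺ distinct? (words-inRange (range1 m) (range1-inRange m) m) )

countBelow-∷-≥ : ∀ {c y} → c ≤ y → ∀ ys → countBelow c (y ∷ ys) ≡ countBelow c ys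
countBelow-∷-≥ {c} {y} c≤y ys with y <? c
... | yes y<c = contradiction c≤y (<⇒≱ y<c)
... | no _ = refl

countBelow-≥ : ∀ {c xs} → All (c ≤_) xs → countBelow c xs ≡ 0
countBelow-≥ [] = refl
countBelow-≥ {xs = x ∷ xs} (c≤x ∷ rest) = trans (countBelow-∷-≥ c≤x xs) (countBelow-≥ rest)

countBelow-< : ∀ {c xs} → All (_< c) xs → countBelow c xs ≡ length xs
countBelow-< [] = refl
countBelow-< {c} {x ∷ xs} (x<c ∷ rest) with x <? c
... | yes _ = cong suc (countBelow-< rest)
... | no x≮c = contradiction x<c x≮c

countBelow-map : ∀ {f : ℕ → ℕ} {c c′} → (∀ {y} → f y < c ⇔ y < c′) →
                 ∀ ys → countBelow c (map f ys) ≡ countBelow c′ ys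
countBelow-map f⇔ [] = refl
countBelow-map {f} {c} {c′} f⇔ (y ∷ ys) with f y <? c | y <? c′
... | yes _ | yes _ = cong suc (countBelow-map f⇔ ys)
... | no _ | no _ = countBelow-map f⇔ ys
... | yes fy<c | no y≮c′ = contradiction (to f⇔ fy<c) y≮c′
... | no fy≮c | yes y<c′ = contradiction (from f⇔ y<c′) fy≮c

countBelow-suc-∉ : ∀ {i xs} → All (i ≢_) xs → countBelow (suc i) xs ≡ countBelow i xs
countBelow-suc-∉ [] = refl
countBelow-suc-∉ {i} {x ∷ xs} (i≢x ∷ rest) with x <? suc i | x <? i
... | yes _ | yes _ = cong suc (countBelow-suc-∉ rest)
... | no _ | no _ = countBelow-suc-∉ rest
... | yes x<1+i | no x≮i = contradiction (≤-antisym (≮⇒≥ x≮i) (≤-pred x<1+i)) i≢x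
... | no x≮1+i | yes x<i = contradiction (m<n⇒m<1+n x<i) x≮1+i

countBelow-suc-≤ : ∀ {i xs} → AllPairs _≢_ xs → countBelow (suc i) xs ≤ suc (countBelow i xs)
countBelow-suc-≤ [] = z≤n
countBelow-suc-≤ {i} {x ∷ xs} (x∉xs ∷ d) with x <? suc i | x <? i
... | yes _ | yes _ = s≤s (countBelow-suc-≤ d)
... | no _ | no _ = countBelow-suc-≤ d
... | yes x<1+i | no x≮i rewrite ≤-antisym (≤-pred x<1+i) (≮⇒≥ x≮i) = s≤s (≤-reflexive (countBelow-suc-∉ x∉xs))
... | no x≮1+i | yes x<i = contradiction (m<n⇒m<1+n x<i) x≮1+i

countBelow-+-≤ : ∀ {i xs} → AllPairs _≢_ xs → ∀ d → countBelow (d + i) xs ≤ d + countBelow i xs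
countBelow-+-≤ d-xs zero = ≤-refl
countBelow-+-≤ d-xs (suc d) = ≤-trans (countBelow-suc-≤ d-xs) (s≤s (countBelow-+-≤ d-xs d))

-- countBelow c is 1-Lipschitz in c on a list of distinct letters, and it climbs from 0 at c = 1 to m at c = m + 1.
countBelow-isPerm : ∀ {m k w} → IsPerm m w → k ≤ m → countBelow (suc k) w ≡ k
countBelow-isPerm {m} {k} {w} p k≤m = ≤-antisym upper lower
  where
  open IsPerm p
  open ≤-Reasoning
  upper : countBelow (suc k) w ≤ k
  upper = begin
    countBelow (suc k) w  ≡⟨ cong (λ c → countBelow c w) (+-comm 1 k) ⟩
    countBelow (k + 1) w  ≤⟨ countBelow-+-≤ distinct k ⟩
    k + countBelow 1 w    ≡⟨ cong (k +_) (countBelow-≥ (All.map proj₁ inRange)) ⟩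
    k + 0                 ≡⟨ +-identityʳ k ⟩
    k                     ∎
  lower : k ≤ countBelow (suc k) w
  lower = +-cancelˡ-≤ (m ∸ k) k _ (begin
    (m ∸ k) + k                             ≡⟨ m∸n+n≡m k≤m ⟩
    m                                       ≡⟨ length≡ ⟨
    length w                                ≡⟨ countBelow-< (All.map (s≤s ∘ proj₂) inRange) ⟨
    countBelow (suc m) w                    ≡⟨ cong (λ c → countBelow c w) (trans (+-suc (m ∸ k) k) (cong suc (m∸n+n≡m k≤m))) ⟨
    countBelow ((m ∸ k) + suc k) w          ≤⟨ countBelow-+-≤ distinct (m ∸ k) ⟩
    (m ∸ k) + countBelow (suc k) w          ∎)

occFrom-map : ∀ {f : ℕ → ℕ} → (∀ {x y} → f x < f y ⇔ x < y) → ∀ x ys → occFrom (f x) (map f ys) ≡ occFrom x ys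
occFrom-map f⇔ x [] = refl
occFrom-map {f} f⇔ x (y ∷ rest) with x <? y
... | yes x<y rewrite dec-true (f x <? f y) (from f⇔ x<y) | dec-true (x <? y) x<y =
  cong₂ _+_ (countBelow-map f⇔ rest) (occFrom-map f⇔ y rest)
... | no x≮y rewrite dec-false (f x <? f y) (x≮y ∘ to f⇔) | dec-false (x <? y) x≮y = occFrom-map f⇔ y rest

occ231-extend-below : ∀ {i y} rest → y < i → occ231 (extend i (y ∷ rest)) ≡ occ231 (y ∷ rest)
occ231-extend-below {i} {y} rest y<i
  rewrite dec-false (i <? punchIn i y) (<⇒≯ (from (punchIn-<-self⇔ i) y<i)) = occFrom-map (punchIn-<⇔ i) y rest

occ231-extend-above : ∀ {m k y} rest → IsPerm m (y ∷ rest) → suc k ≤ y → k ≤ m →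
                      occ231 (extend (suc k) (y ∷ rest)) ≡ occ231 (y ∷ rest) + k
occ231-extend-above {m} {k} {y} rest p i≤y k≤m
  rewrite dec-true (suc k <? punchIn (suc k) y) (subst (suc k <_) (sym (punchIn-≥ i≤y)) (s≤s i≤y)) = begin
    countBelow i (map (punchIn i) rest) + occFrom (punchIn i y) (map (punchIn i) rest)
      ≡⟨ cong₂ _+_ (countBelow-map (punchIn-<-self⇔ i) rest) (occFrom-map (punchIn-<⇔ i) y rest) ⟩
    countBelow i rest + occFrom y rest
      ≡⟨ cong (_+ occFrom y rest) (trans (sym (countBelow-∷-≥ i≤y rest)) (countBelow-isPerm p k≤m)) ⟩
    k + occFrom y rest
      ≡⟨ +-comm k _ ⟩
    occFrom y rest + k ∎
  where
  open ≡-Reasoning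
  i : ℕ
  i = suc k

HasOcc : ℤ → List ℕ → Set
HasOcc r w = ℤ.+ occ231 w ≡ r

hasOcc? : ∀ r → Decidable (HasOcc r)
hasOcc? r w = ℤ.+ occ231 w ℤ.≟ r

count : ℤ → List (List ℕ) → ℕ
count r X = length (filter (hasOcc? r) X)

countExact≡count : ∀ r X → countExact r X ≡ count (ℤ.+ r) X
countExact≡count r X = cong length (List.filter-≐ _ (hasOcc? (ℤ.+ r)) (cong (λ n → ℤ.+ n) , ℤ.+-injective) X)

count-negative : ∀ k X → count ℤ.-[1+ k ] X ≡ 0
count-negative k X = cong length (List.filter-none (hasOcc? ℤ.-[1+ k ]) (All.universal (λ _ ()) X))

vi≡count : ∀ r m j → vi r m j ≡ count r (filter (startsWith? j) (perms m))
vi≡count (ℤ.+ r) m j = countExact≡count r (filter (startsWith? j) (perms m))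
vi≡count ℤ.-[1+ k ] m j = sym (count-negative k (filter (startsWith? j) (perms m)))

v≡count : ∀ r m → v r m ≡ count r (perms m)
v≡count (ℤ.+ r) m = countExact≡count r (perms m)
v≡count ℤ.-[1+ k ] m = sym (count-negative k (perms m))

count-map : ∀ r (f : List ℕ → List ℕ) X → count r (map f X) ≡ length (filter (hasOcc? r ∘ f) X)
count-map r f X = trans (cong length (filter-map (hasOcc? r) f X)) (List.length-map f (filter (hasOcc? r ∘ f) X))

x+y≡z⇔x≡z-y : ∀ x y z → x ℤ.+ y ≡ z ⇔ x ≡ z ℤ.- y
x+y≡z⇔x≡z-y x y z = mk⇔
  (λ eq → trans (sym (solve 2 (λ x y → (x :+ y) :- y := x) refl x y)) (cong (ℤ._- y) eq))
  (λ eq → trans (cong (ℤ._+ y) eq) (solve 2 (λ z y → (z :- y) :+ y := z) refl z y))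
  where open +-*-Solver

count-shift : ∀ r (f : List ℕ → List ℕ) {c X} → All (λ w → occ231 (f w) ≡ occ231 w + c) X →
              length (filter (hasOcc? r ∘ f) X) ≡ count (r ℤ.- ℤ.+ c) X
count-shift r f {c} shifts = cong length (filter-≐-local _ _ (All.map (λ {w} → shift⇔ w) shifts))
  where
  shift⇔ : ∀ w → occ231 (f w) ≡ occ231 w + c → HasOcc r (f w) ⇔ HasOcc (r ℤ.- ℤ.+ c) w
  shift⇔ w eq = subst (λ n → ℤ.+ n ≡ r ⇔ HasOcc (r ℤ.- ℤ.+ c) w) (sym eq)
    (subst (λ x → x ≡ r ⇔ HasOcc (r ℤ.- ℤ.+ c) w) (sym (ℤ.pos-+ (occ231 w) c))
      (x+y≡z⇔x≡z-y (ℤ.+ occ231 w) (ℤ.+ c) r))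

count-by-head : ∀ {p} {P : List ℕ → Set p} (P? : Decidable P) m {X} → All (λ w → ∃[ y ] startsWith y w × InRange m y) X →
                length (filter P? X) ≡ sum (map (λ j → length (filter P? (filter (startsWith? j) X))) (range1 m))
count-by-head P? m [] = sym (sum-map-0 (All.universal (λ _ → refl) (range1 m)))
count-by-head P? m {w ∷ X} ((y , w↦y , y-in) ∷ heads) = begin
  length (filter P? (w ∷ X))
    ≡⟨ split [ w ] X ⟩
  length (filter P? [ w ]) + length (filter P? X)
    ≡⟨ cong₂ _+_ (sym (trans (sum-range1-single y-in only-y) at-y)) (count-by-head P? m heads) ⟩
  sum (map C (range1 m)) + sum (map D (range1 m))
    ≡⟨ sum-map-+ C D (range1 m) ⟨
  sum (map (λ j → C j + D j) (range1 m))
    ≡⟨ cong sum (List.map-cong (λ j → sym (split-startsWith j)) (range1 m)) ⟩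
  sum (map (λ j → length (filter P? (filter (startsWith? j) (w ∷ X)))) (range1 m)) ∎
  where
  open ≡-Reasoning
  C D : ℕ → ℕ
  C j = length (filter P? (filter (startsWith? j) [ w ]))
  D j = length (filter P? (filter (startsWith? j) X))
  split : ∀ V W → length (filter P? (V ++ W)) ≡ length (filter P? V) + length (filter P? W)
  split V W = trans (cong length (List.filter-++ P? V W)) (List.length-++ (filter P? V))
  split-startsWith : ∀ j → length (filter P? (filter (startsWith? j) (w ∷ X))) ≡ C j + D j
  split-startsWith j = trans (cong (length ∘ filter P?) (List.filter-++ (startsWith? j) [ w ] X))
                             (split (filter (startsWith? j) [ w ]) (filter (startsWith? j) X))
  only-y : ∀ j → j ≢ y → C j ≡ 0
  only-y j j≢y = cong (length ∘ filter P?)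
    (List.filter-reject (startsWith? j) (λ w↦j → j≢y (Maybe.just-injective (trans (sym w↦j) w↦y))))
  at-y : C y ≡ length (filter P? [ w ])
  at-y = cong (length ∘ filter P?) (List.filter-accept (startsWith? y) w↦y)

isPerm-head : ∀ {m w} → 1 ≤ m → IsPerm m w → ∃[ y ] startsWith y w × InRange m y
isPerm-head {w = []} 1≤m p = contradiction (IsPerm.length≡ p) (<⇒≢ 1≤m)
isPerm-head {w = y ∷ _} _ p = y , refl , All.head (IsPerm.inRange p)

startsWith-isPerm : ∀ j m → All (λ w → startsWith j w × IsPerm m w) (filter (startsWith? j) (perms m))
startsWith-isPerm j m = All.zip (All.all-filter (startsWith? j) (perms m) , All.filter⁺ (startsWith? j) (perms-isPerm m))

occ231-extend-1 : ∀ {m w} → IsPerm m w → occ231 (extend 1 w) ≡ occ231 w + 0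
occ231-extend-1 {w = []} _ = refl
occ231-extend-1 {w = y ∷ rest} p = occ231-extend-above rest p (proj₁ (All.head (IsPerm.inRange p))) z≤n

occ231-extend-last : ∀ {m w} → IsPerm m w → occ231 (extend (suc m) w) ≡ occ231 w + 0
occ231-extend-last {w = []} _ = refl
occ231-extend-last {w = y ∷ rest} p =
  trans (occ231-extend-below rest (s≤s (proj₂ (All.head (IsPerm.inRange p))))) (sym (+-identityʳ (occ231 (y ∷ rest))))

vi-suc≡ : ∀ r {i m} → InRange (suc m) i → vi r (suc m) i ≡ length (filter (hasOcc? r ∘ extend i) (perms m))
vi-suc≡ r {i} {m} i-in = begin
  vi r (suc m) i                                     ≡⟨ vi≡count r (suc m) i ⟩
  count r (filter (startsWith? i) (perms (suc m)))   ≡⟨ cong (count r) (perms-startsWith i-in) ⟩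
  count r (map (extend i) (perms m))                 ≡⟨ count-map r (extend i) (perms m) ⟩
  length (filter (hasOcc? r ∘ extend i) (perms m))   ∎
  where open ≡-Reasoning

vi-suc-unshifted : ∀ r {i m} → InRange (suc m) i → All (λ w → occ231 (extend i w) ≡ occ231 w + 0) (perms m) →
                   vi r (suc m) i ≡ v r m
vi-suc-unshifted r {i} {m} i-in unshifted = begin
  vi r (suc m) i                                     ≡⟨ vi-suc≡ r i-in ⟩
  length (filter (hasOcc? r ∘ extend i) (perms m))   ≡⟨ count-shift r (extend i) unshifted ⟩
  count (r ℤ.- ℤ.+ 0) (perms m)                      ≡⟨ cong (λ r → count r (perms m)) (ℤ.+-identityʳ r) ⟩
  count r (perms m)                                  ≡⟨ v≡count r m ⟨
  v r m                                              ∎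
  where open ≡-Reasoning

count-extend-startsWith-below : ∀ r {i j} m → j < i →
  length (filter (hasOcc? r ∘ extend i) (filter (startsWith? j) (perms m))) ≡ vi r m j
count-extend-startsWith-below r {i} {j} m j<i = begin
  length (filter (hasOcc? r ∘ extend i) (filter (startsWith? j) (perms m)))
    ≡⟨ count-shift r (extend i) (All.map unshifted (startsWith-isPerm j m)) ⟩
  count (r ℤ.- ℤ.+ 0) (filter (startsWith? j) (perms m))
    ≡⟨ cong (λ r → count r (filter (startsWith? j) (perms m))) (ℤ.+-identityʳ r) ⟩
  count r (filter (startsWith? j) (perms m))
    ≡⟨ vi≡count r m j ⟨
  vi r m j ∎
  where
  open ≡-Reasoning
  unshifted : ∀ {w} → startsWith j w × IsPerm m w → occ231 (extend i w) ≡ occ231 w + 0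
  unshifted {y ∷ rest} (refl , _) = trans (occ231-extend-below rest j<i) (sym (+-identityʳ _))

count-extend-startsWith-above : ∀ r {k j} m → suc k ≤ j → k ≤ m →
  length (filter (hasOcc? r ∘ extend (suc k)) (filter (startsWith? j) (perms m))) ≡ vi ((r ℤ.- ℤ.+ suc k) ℤ.+ ℤ.+ 1) m j
count-extend-startsWith-above r {k} {j} m i≤j k≤m = begin
  length (filter (hasOcc? r ∘ extend (suc k)) (filter (startsWith? j) (perms m)))
    ≡⟨ count-shift r (extend (suc k)) (All.map shifted (startsWith-isPerm j m)) ⟩
  count (r ℤ.- ℤ.+ k) (filter (startsWith? j) (perms m))
    ≡⟨ cong (λ r → count r (filter (startsWith? j) (perms m))) r-k≡r-[1+k]+1 ⟩
  count r′ (filter (startsWith? j) (perms m))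
    ≡⟨ vi≡count r′ m j ⟨
  vi r′ m j ∎
  where
  open ≡-Reasoning
  r′ : ℤ
  r′ = (r ℤ.- ℤ.+ suc k) ℤ.+ ℤ.+ 1
  shifted : ∀ {w} → startsWith j w × IsPerm m w → occ231 (extend (suc k) w) ≡ occ231 w + k
  shifted {y ∷ rest} (refl , p) = occ231-extend-above rest p i≤j k≤m
  r-k≡r-[1+k]+1 : r ℤ.- ℤ.+ k ≡ r′
  r-k≡r-[1+k]+1 = solve 2 (λ r k → r :- k := (r :- (con (ℤ.+ 1) :+ k)) :+ con (ℤ.+ 1)) refl r (ℤ.+ k)
    where open +-*-Solver

lemma5 : (r : ℤ) (n : ℕ) → 1 ≤ n →
    (vi r n 1 ≡ v r (n ∸ 1) × vi r n n ≡ v r (n ∸ 1))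
    × ((i : ℕ) → 2 ≤ i → i ≤ n ∸ 1 →
        vi r n i ≡ sumFromTo 1 (i ∸ 1) (λ j → vi r (n ∸ 1) j)
                   + sumFromTo i (n ∸ 1) (λ j → vi ((r ℤ.- ℤ.+ i) ℤ.+ ℤ.+ 1) (n ∸ 1) j))
lemma5 r (suc m) _ =
  ( vi-suc-unshifted r (≤-refl , s≤s z≤n) (All.map occ231-extend-1 (perms-isPerm m))
  , vi-suc-unshifted r (s≤s z≤n , ≤-refl) (All.map occ231-extend-last (perms-isPerm m)) )
  , middle
  where
  middle : (i : ℕ) → 2 ≤ i → i ≤ m →
           vi r (suc m) i ≡ sumFromTo 1 (i ∸ 1) (λ j → vi r m j) + sumFromTo i m (λ j → vi ((r ℤ.- ℤ.+ i) ℤ.+ ℤ.+ 1) m j)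
  middle (suc k) (s≤s _) i≤m = begin
    vi r (suc m) (suc k)
      ≡⟨ vi-suc≡ r i-in ⟩
    length (filter (hasOcc? r ∘ extend (suc k)) (perms m))
      ≡⟨ count-by-head _ m (All.map (isPerm-head (≤-trans (s≤s z≤n) i≤m)) (perms-isPerm m)) ⟩
    sum (map F (range1 m))
      ≡⟨ sum-range1-split F m (m≤n⇒m≤1+n i≤m) ⟩
    sumFromTo 1 k F + sumFromTo (suc k) m F
      ≡⟨ cong₂ _+_ (sumFromTo-cong {1} {k} (λ _ j≤k → count-extend-startsWith-below r m (s≤s j≤k)))
                   (sumFromTo-cong {suc k} {m} (λ i≤j _ → count-extend-startsWith-above r m i≤j (≤-trans (n≤1+n k) i≤m))) ⟩
    sumFromTo 1 k (λ j → vi r m j) + sumFromTo (suc k) m (λ j → vi ((r ℤ.- ℤ.+ suc k) ℤ.+ ℤ.+ 1) m j) ∎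
    where
    open ≡-Reasoning
    i-in : InRange (suc m) (suc k)
    i-in = s≤s z≤n , m≤n⇒m≤1+n i≤m
    F : ℕ → ℕ
    F j = length (filter (hasOcc? r ∘ extend (suc k)) (filter (startsWith? j) (perms m)))
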